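{- Let $k,\ell,r,d$ be integers with $\ell\ge1$, $0\le r<k$, $0\le d\le\ell$, let $p\in[0,1/2)$ and $n=k+\ell$. Consider points $x^{(1)},\dots,x^{(m)}\in\{0,1\}^n$ and bits $y_1,\dots,y_m$, and let $E$ be the event that for all $i,j$, either $x^{(i)}|_{[n]\setminus\mathbf{J}}\ne x^{(j)}|_{[n]\setminus\mathbf{J}}$ or $\mathrm{dist}(x^{(i)},x^{(j)})\le d$; assume $E$ has positive probability under $\mathcal{D}_{YES}$. Then \[\Pr_{\mathbf{f},\mathbf{J}\sim\mathcal{D}_{YES}}[\forall i\ \mathbf{f}(x^{(i)})=y_i\mid E]=\Pr_{\mathbf{f}\sim\mathcal{D}_{NO}}[\forall i\ \mathbf{f}(x^{(i)})=y_i].\]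
   Context: $x|_S$ is restriction to coordinates $S$; $\mathrm{dist}$ is Hamming distance; $B_\ell(d)$ is the Hamming ball of radius $d$ around $0^\ell$; $\mathrm{Bern}(p)$ is Bernoulli with mean $p$. $\mathcal{D}_{NO}$: a random $\mathbf{f}:\{0,1\}^n\to\{0,1\}$ with, independently for each $x$, $\mathbf{f}(x)\sim\mathrm{Bern}(p)$ if $x|_{[r]}\ne0^r$ and $\mathbf{f}(x)$ uniform if $x|_{[r]}=0^r$. $\mathcal{D}_{YES}$: choose a uniformly random $\mathbf{J}\subseteq\{r+1,\dots,n\}$ of size $\ell$; let $\chi:\{0,1\}^{\mathbf{J}}\to[|B_\ell(d)|]$ be a coloring such that distinct points at Hamming distance at most $d$ receive different colors (a fixed such coloring for each $\mathbf{J}$); for each $\rho\in\{0,1\}^{[n]\setminus\mathbf{J}}$ sample independent uniform bits $\mathbf{y}^\rho_1,\dots,\mathbf{y}^\rho_{|B_\ell(d)|}$; for each $x$ with $x|_{[r]}\ne0^r$ independently draw $\mathbf{f}(x)\sim\mathrm{Bern}(p)$; for each $x$ with $x|_{[r]}=0^r$ set $\mathbf{f}(x)=\mathbf{y}^{x|_{[n]\setminus\mathbf{J}}}_{\chi(x|_{\mathbf{J}})}$.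
   Formalization: The parameter p ranges over the rational numbers in $[0,1/2)$. -}

module Defs where

open import Data.Bool using (Bool; true; false; _∧_; _∨_; not; if_then_else_)
open import Data.Nat using (ℕ; zero; suc; _<ᵇ_; _≡ᵇ_; _≤_)
open import Data.Nat.Combinatorics using (_C_)
open import Data.Fin using (Fin; toℕ)
open import Data.Vec using (Vec; []; _∷_; zipWith; allFin)
import Data.Vec as V
open import Data.List using (List; []; _∷_; map; concatMap; filterᵇ; length; foldr)
open import Data.Product using (_×_; _,_)
open import Data.Integer using (+_)
open import Data.Rational using (ℚ; 0ℚ; 1ℚ; ½; _+_; _*_; _-_; _/_; _÷_; Positive)
open import Data.Rational.Properties using (pos⇒nonZero)
open import Relation.Binary.Definitions using (DecidableEquality)
open import Relation.Nullary.Decidable using (isYes)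
import Data.Bool.Properties as BoolP
import Data.Vec.Properties as VecP
import Data.Product.Properties as ProdP
import Data.Fin.Properties as FinP

-- Points of {0,1}^n are Vec Bool n; coordinates are Fin n, where the
-- paper's coordinate i ∈ [n] = {1..n} is the index i-1.
-- A subset S ⊆ [n] is a characteristic vector Vec Bool n.

Point : ℕ → Set
Point n = Vec Bool n

_≟V_ : ∀ {n} → DecidableEquality (Point n)
_≟V_ = VecP.≡-dec BoolP._≟_

eqV : ∀ {n} → Point n → Point n → Bool
eqV u v = isYes (u ≟V v)

allPoints : (n : ℕ) → List (Point n)
allPoints zero = [] ∷ []
allPoints (suc n) = concatMap (λ v → (true ∷ v) ∷ (false ∷ v) ∷ []) (allPoints n)

weight : ∀ {n} → Vec Bool n → ℕ
weight [] = 0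
weight (true ∷ v) = suc (weight v)
weight (false ∷ v) = weight v

dist : ∀ {n} → Point n → Point n → ℕ
dist [] [] = 0
dist (a ∷ u) (b ∷ v) = if isYes (a BoolP.≟ b) then dist u v else suc (dist u v)

-- restriction x|_S, represented by zeroing the coordinates outside S
-- (this identifies {0,1}^S with the points supported on S)
restrict : ∀ {n} → Vec Bool n → Point n → Point n
restrict S x = zipWith _∧_ S x

compl : ∀ {n} → Vec Bool n → Vec Bool n
compl = V.map not

prefixNonZero : ∀ {n} → ℕ → Point n → Bool
prefixNonZero {n} r x = V.foldr _ _∨_ false (zipWith (λ i b → (toℕ i <ᵇ r) ∧ b) (allFin n) x)

-- S ⊆ {r+1,…,n}, i.e. S contains no index < r (0-based)
avoidsPrefix : ∀ {n} → ℕ → Vec Bool n → Bool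
avoidsPrefix {n} r S = V.foldr _ _∧_ true (zipWith (λ i s → not (s ∧ (toℕ i <ᵇ r))) (allFin n) S)

validJ : ∀ {n} → ℕ → ℕ → Vec Bool n → Bool
validJ r ℓ J = avoidsPrefix r J ∧ (weight J ≡ᵇ ℓ)

allValidJ : (n r ℓ : ℕ) → List (Vec Bool n)
allValidJ n r ℓ = filterᵇ (validJ r ℓ) (allPoints n)

ballSize : ℕ → ℕ → ℕ
ballSize ℓ zero = ℓ C 0
ballSize ℓ (suc d) = ballSize ℓ d Data.Nat.+ ℓ C (suc d)

ProperColoring : ∀ {n} (r ℓ d : ℕ) → (Vec Bool n → Point n → Fin (ballSize ℓ d)) → Set
ProperColoring r ℓ d χ = ∀ J → validJ r ℓ J ≡ true → ∀ x x' →
  restrict J x ≢ restrict J x' → dist (restrict J x) (restrict J x') ≤ d →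
  χ J (restrict J x) ≢ χ J (restrict J x')
  where open import Relation.Binary.PropositionalEquality using (_≡_; _≢_)

sumℚ : List ℚ → ℚ
sumℚ = foldr _+_ 0ℚ

indicator : Bool → ℚ
indicator true = 1ℚ
indicator false = 0ℚ

bern : ℚ → Bool → ℚ
bern q true = q
bern q false = 1ℚ - q

-- all assignments g : A → Bool of the (repetition-free) domain list
-- (values outside the list are irrelevant and set to false)
assignments : ∀ {A : Set} → DecidableEquality A → List A → List (A → Bool)
assignments eq [] = (λ _ → false) ∷ []
assignments eq (a ∷ as) =
  concatMap (λ g → upd g true ∷ upd g false ∷ []) (assignments eq as)
  where upd : _ → Bool → _
        upd g b z = if isYes (eq z a) then b else g z

Eprod : ∀ {A : Set} → DecidableEquality A → List A → (A → ℚ) → ((A → Bool) → ℚ) → ℚ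
Eprod eq D q F =
  sumℚ (map (λ g → foldr (λ a w → bern (q a) (g a) * w) 1ℚ D * F g) (assignments eq D))

Eunif : ∀ {A : Set} → List A → (A → ℚ) → ℚ
Eunif [] F = 0ℚ
Eunif (a ∷ as) F = sumℚ (map F (a ∷ as)) * ((+ 1) / suc (length as))

PrNO : (n r : ℕ) (p : ℚ) → ((Point n → Bool) → Bool) → ℚ
PrNO n r p Φ =
  Eprod _≟V_ (allPoints n) (λ x → if prefixNonZero r x then p else ½) (λ f → indicator (Φ f))

module _ (n r ℓ d : ℕ) (p : ℚ) (χ : Vec Bool n → Point n → Fin (ballSize ℓ d)) where

  -- index set for the uniform bits y^ρ_c : ρ ∈ {0,1}^{[n]∖J}, c a colour
  yDomain : Vec Bool n → List (Point n × Fin (ballSize ℓ d))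
  yDomain J = concatMap (λ ρ → map (ρ ,_) (Data.List.allFin _))
                        (filterᵇ (λ x → eqV (restrict (compl J) x) x) (allPoints n))

  bDomain : List (Point n)
  bDomain = filterᵇ (prefixNonZero r) (allPoints n)

  fYES : Vec Bool n → (Point n × Fin (ballSize ℓ d) → Bool) → (Point n → Bool) → Point n → Bool
  fYES J yv bv x = if prefixNonZero r x then bv x
                   else yv (restrict (compl J) x , χ J (restrict J x))

  PrYES : (Vec Bool n → (Point n → Bool) → Bool) → ℚ
  PrYES Φ = Eunif (allValidJ n r ℓ) (λ J →
    Eprod (ProdP.≡-dec _≟V_ FinP._≟_) (yDomain J) (λ _ → ½) (λ yv →
      Eprod _≟V_ bDomain (λ _ → p) (λ bv → indicator (Φ J (fYES J yv bv)))))

condProb : (AE E : ℚ) → Positive E → ℚ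
condProb AE E posE = (AE ÷ E) {{pos⇒nonZero E {{posE}}}}

allMatch : ∀ {n m} → (Fin m → Point n) → (Fin m → Bool) → (Point n → Bool) → Bool
allMatch {m = m} x y f = V.foldr _ _∧_ true (V.map (λ i → isYes (f (x i) BoolP.≟ y i)) (allFin m))

eventE : ∀ {n m} → ℕ → (Fin m → Point n) → Vec Bool n → Bool
eventE {m = m} d x J = V.foldr _ _∧_ true (V.map (λ i → V.foldr _ _∧_ true (V.map (λ j →
  not (eqV (restrict (compl J) (x i)) (restrict (compl J) (x j))) ∨ (dist (x i) (x j) Data.Nat.≤ᵇ d))
  (allFin m))) (allFin m))

module Submission where

-- Fix J. Under D_YES each value f(x) is one of the independent bits of the construction (the Bern(p) bit
-- of x if x|_[r] ≠ 0^r, otherwise the uniform bit y^ρ_c with ρ = x|_{[n]∖J} and c = χ(x|_J)), and its bias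
-- is the bias of f(x) under D_NO. The joint law of the answers depends only on these biases and on which
-- queries read a common bit, and when E holds distinct queries read distinct bits, exactly as under D_NO.
-- Hence Pr_YES[match ∧ E | J] = [E(J)] · Pr_NO[match] for every J, and averaging over J gives the claim.

module FiniteProbability where

  open import Defs using (sumℚ; indicator; bern; assignments; Eprod; Eunif; condProb)
  open import Data.Bool using (Bool; true; false; _∧_; if_then_else_)
  import Data.Bool.Properties as Bool
  open import Data.Empty using (⊥-elim)
  open import Data.List using (List; []; _∷_; map; concatMap; foldr)
  open import Data.List.Membership.Propositional using (_∈_)
  open import Data.List.Relation.Unary.All as All using (All; []; _∷_)
  open import Data.List.Relation.Unary.Any using (here; there)
  open import Data.List.Relation.Unary.AllPairs using ([]; _∷_)
  open import Data.List.Relation.Unary.Unique.Propositional using (Unique)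
  open import Data.Maybe using (Maybe; just; nothing)
  open import Data.Product using (_×_; _,_; proj₁)
  open import Data.Rational using (ℚ; 0ℚ; 1ℚ; _+_; _*_; Positive; 1/_)
  open import Data.Rational.Properties
    using (*-assoc; +-identityʳ; *-identityˡ; *-identityʳ; *-zeroˡ; *-zeroʳ; *-distribˡ-+; +-assoc; *-inverseʳ; pos⇒nonZero)
  open import Data.Rational.Solver using (module +-*-Solver)
  open import Function using (_∘_)
  open import Relation.Binary.Definitions using (DecidableEquality)
  open import Relation.Binary.PropositionalEquality
  open import Relation.Nullary using (yes; no)
  open import Relation.Nullary.Decidable using (isYes)
  open +-*-Solver
  open ≡-Reasoning

  sumℚ-map-cong : ∀ {B : Set} {h h′ : B → ℚ} (L : List B) →
                  (∀ {b} → b ∈ L → h b ≡ h′ b) → sumℚ (map h L) ≡ sumℚ (map h′ L)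
  sumℚ-map-cong []      e = refl
  sumℚ-map-cong (b ∷ L) e = cong₂ _+_ (e (here refl)) (sumℚ-map-cong L (e ∘ there))

  sumℚ-map-*ˡ : ∀ {B : Set} c (h : B → ℚ) (L : List B) →
                sumℚ (map (λ b → c * h b) L) ≡ c * sumℚ (map h L)
  sumℚ-map-*ˡ c h []      = sym (*-zeroʳ c)
  sumℚ-map-*ˡ c h (b ∷ L) =
    trans (cong (c * h b +_) (sumℚ-map-*ˡ c h L)) (sym (*-distribˡ-+ c (h b) _))

  sumℚ-concatMap-pair : ∀ {B C : Set} (h : C → ℚ) (u v : B → C) (L : List B) →
    sumℚ (map h (concatMap (λ b → u b ∷ v b ∷ []) L)) ≡ sumℚ (map (λ b → h (u b) + h (v b)) L)
  sumℚ-concatMap-pair h u v []      = refl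
  sumℚ-concatMap-pair h u v (b ∷ L) =
    trans (sym (+-assoc (h (u b)) (h (v b)) _)) (cong (h (u b) + h (v b) +_) (sumℚ-concatMap-pair h u v L))

  Eunif-cong : ∀ {B : Set} {h h′ : B → ℚ} (L : List B) →
               (∀ {b} → b ∈ L → h b ≡ h′ b) → Eunif L h ≡ Eunif L h′
  Eunif-cong []      e = refl
  Eunif-cong (b ∷ L) e = cong (_* _) (sumℚ-map-cong (b ∷ L) e)

  Eunif-*ˡ : ∀ {B : Set} c (h : B → ℚ) (L : List B) → Eunif L (λ b → c * h b) ≡ c * Eunif L h
  Eunif-*ˡ c h []      = sym (*-zeroʳ c)
  Eunif-*ˡ c h (b ∷ L) = trans (cong (_* _) (sumℚ-map-*ˡ c h (b ∷ L))) (*-assoc c _ _)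

  condProb-*ˡ : ∀ c Z (Z>0 : Positive Z) → condProb (c * Z) Z Z>0 ≡ c
  condProb-*ˡ c Z Z>0 = begin
    c * Z * 1/ Z    ≡⟨ *-assoc c Z (1/ Z) ⟩
    c * (Z * 1/ Z)  ≡⟨ cong (c *_) (*-inverseʳ Z) ⟩
    c * 1ℚ          ≡⟨ *-identityʳ c ⟩
    c               ∎
    where
    instance _ = pos⇒nonZero Z {{Z>0}}

  bern-average : ∀ q u → bern q true * u + bern q false * u ≡ u
  bern-average = solve 2 (λ q u → q :* u :+ (con 1ℚ :- q) :* u := u) refl

  indicator-∧ : ∀ a c → indicator (a ∧ c) ≡ indicator a * indicator c
  indicator-∧ true  c = sym (*-identityˡ (indicator c))
  indicator-∧ false c = sym (*-zeroˡ (indicator c))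

  𝟙[_≐_] : Bool → Bool → ℚ
  𝟙[ u ≐ b ] = indicator (isYes (u Bool.≟ b))

  module _ {A : Set} (_≟_ : DecidableEquality A) where

    update : (A → Bool) → A → Bool → A → Bool
    update g a b z = if isYes (z ≟ a) then b else g z

    update-same : ∀ g a b → update g a b a ≡ b
    update-same g a b with a ≟ a
    ... | yes _  = refl
    ... | no a≢a = ⊥-elim (a≢a refl)

    update-other : ∀ g a b {z} → z ≢ a → update g a b z ≡ g z
    update-other g a b {z} z≢a with z ≟ a
    ... | yes z≡a = ⊥-elim (z≢a z≡a)
    ... | no _    = refl

    likelihood : List A → (A → ℚ) → (A → Bool) → ℚ
    likelihood D q g = foldr (λ a w → bern (q a) (g a) * w) 1ℚ D

    likelihood-cong : ∀ D q {g g′} → All (λ z → g z ≡ g′ z) D → likelihood D q g ≡ likelihood D q g′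
    likelihood-cong []      q []       = refl
    likelihood-cong (a ∷ D) q (e ∷ es) = cong₂ (λ u v → bern (q a) u * v) e (likelihood-cong D q es)

    Eprod-cong : ∀ D q {F F′ : (A → Bool) → ℚ} → (∀ g → F g ≡ F′ g) → Eprod _≟_ D q F ≡ Eprod _≟_ D q F′
    Eprod-cong D q e = sumℚ-map-cong (assignments _≟_ D) (λ {g} _ → cong (likelihood D q g *_) (e g))

    Eprod-*ˡ : ∀ D q c (F : (A → Bool) → ℚ) → Eprod _≟_ D q (λ g → c * F g) ≡ c * Eprod _≟_ D q F
    Eprod-*ˡ D q c F = trans
      (sumℚ-map-cong (assignments _≟_ D) (λ {g} _ →
        solve 3 (λ w c f → w :* (c :* f) := c :* (w :* f)) refl (likelihood D q g) c (F g)))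
      (sumℚ-map-*ˡ c (λ g → likelihood D q g * F g) (assignments _≟_ D))

    Eprod-∷ : ∀ a D q F → All (a ≢_) D →
      Eprod _≟_ (a ∷ D) q F ≡
      Eprod _≟_ D q (λ g → bern (q a) true * F (update g a true) + bern (q a) false * F (update g a false))
    Eprod-∷ a D q F a∉D =
      trans (sumℚ-concatMap-pair (λ g → likelihood (a ∷ D) q g * F g)
                                 (λ g → update g a true) (λ g → update g a false) (assignments _≟_ D))
            (sumℚ-map-cong (assignments _≟_ D) (λ {g} _ → split g))
      where
      likelihood-update : ∀ g b → likelihood D q (update g a b) ≡ likelihood D q g
      likelihood-update g b = likelihood-cong D q (All.map (λ a≢z → update-other g a b (a≢z ∘ sym)) a∉D)
      split : ∀ g →
        likelihood (a ∷ D) q (update g a true) * F (update g a true) +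
        likelihood (a ∷ D) q (update g a false) * F (update g a false) ≡
        likelihood D q g * (bern (q a) true * F (update g a true) + bern (q a) false * F (update g a false))
      split g rewrite update-same g a true | update-same g a false
                    | likelihood-update g true | likelihood-update g false =
        solve 5 (λ t f w u v → (t :* w) :* u :+ (f :* w) :* v := w :* (t :* u :+ f :* v)) refl
          (bern (q a) true) (bern (q a) false) (likelihood D q g) (F (update g a true)) (F (update g a false))

    Eprod-const : ∀ D q c → Unique D → Eprod _≟_ D q (λ _ → c) ≡ c
    Eprod-const []      q c []          = trans (+-identityʳ (1ℚ * c)) (*-identityˡ c)
    Eprod-const (a ∷ D) q c (a∉D ∷ uD) = begin
      Eprod _≟_ (a ∷ D) q (λ _ → c)  ≡⟨ Eprod-∷ a D q _ a∉D ⟩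
      Eprod _≟_ D q (λ _ → bern (q a) true * c + bern (q a) false * c)
        ≡⟨ Eprod-cong D q (λ _ → bern-average (q a) c) ⟩
      Eprod _≟_ D q (λ _ → c)        ≡⟨ Eprod-const D q c uD ⟩
      c                              ∎

    Ignores : A → ((A → Bool) → ℚ) → Set
    Ignores a G = ∀ h h′ → (∀ {z} → z ≢ a → h z ≡ h′ z) → G h ≡ G h′

    Ignores-update : ∀ {a G} g b → Ignores a G → G (update g a b) ≡ G g
    Ignores-update {a} g b ign = ign _ _ (update-other g a b)

    Eprod-∷-ignored : ∀ a D q G → All (a ≢_) D → Ignores a G → Eprod _≟_ (a ∷ D) q G ≡ Eprod _≟_ D q G
    Eprod-∷-ignored a D q G a∉D ign = trans (Eprod-∷ a D q G a∉D) (Eprod-cong D q λ g →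
      trans (cong₂ (λ u v → bern (q a) true * u + bern (q a) false * v)
                   (Ignores-update g true ign) (Ignores-update g false ign))
            (bern-average (q a) (G g)))

    Eprod-𝟙 : ∀ D → Unique D → ∀ {a} → a ∈ D → ∀ q b G → Ignores a G →
              Eprod _≟_ D q (λ g → 𝟙[ g a ≐ b ] * G g) ≡ bern (q a) b * Eprod _≟_ D q G
    Eprod-𝟙 (c ∷ D) (c∉D ∷ uD) (here refl) q b G ign =
      trans (Eprod-∷ c D q _ c∉D)
        (trans (Eprod-cong D q (pick b))
          (trans (Eprod-*ˡ D q (bern (q c) b) G)
            (cong (bern (q c) b *_) (sym (Eprod-∷-ignored c D q G c∉D ign)))))
      where
      pick : ∀ b g →
        bern (q c) true * (𝟙[ update g c true c ≐ b ] * G (update g c true)) +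
        bern (q c) false * (𝟙[ update g c false c ≐ b ] * G (update g c false)) ≡ bern (q c) b * G g
      pick b g rewrite update-same g c true | update-same g c false
                     | Ignores-update g true ign | Ignores-update g false ign with b
      ... | true  = solve 2 (λ q u → q :* (con 1ℚ :* u) :+ (con 1ℚ :- q) :* (con 0ℚ :* u) := q :* u)
                      refl (q c) (G g)
      ... | false = solve 2 (λ q u → q :* (con 0ℚ :* u) :+ (con 1ℚ :- q) :* (con 1ℚ :* u) := (con 1ℚ :- q) :* u)
                      refl (q c) (G g)
    Eprod-𝟙 (c ∷ D) (c∉D ∷ uD) {a} (there a∈D) q b G ign =
      trans (Eprod-∷ c D q _ c∉D)
        (trans (Eprod-cong D q pull)
          (trans (Eprod-𝟙 D uD a∈D q b averageG averageG-ignores)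
            (cong (bern (q a) b *_) (sym (Eprod-∷ c D q G c∉D)))))
      where
      a≢c : a ≢ c
      a≢c a≡c = All.lookup c∉D a∈D (sym a≡c)
      averageG : (A → Bool) → ℚ
      averageG g = bern (q c) true * G (update g c true) + bern (q c) false * G (update g c false)
      averageG-ignores : Ignores a averageG
      averageG-ignores h h′ h≗h′ = cong₂ (λ u v → bern (q c) true * u + bern (q c) false * v)
        (ign _ _ (update-agrees true)) (ign _ _ (update-agrees false))
        where
        update-agrees : ∀ b′ {z} → z ≢ a → update h c b′ z ≡ update h′ c b′ z
        update-agrees b′ {z} z≢a with z ≟ c
        ... | yes _ = refl
        ... | no _  = h≗h′ z≢a
      pull : ∀ g →
        bern (q c) true * (𝟙[ update g c true a ≐ b ] * G (update g c true)) +
        bern (q c) false * (𝟙[ update g c false a ≐ b ] * G (update g c false)) ≡ 𝟙[ g a ≐ b ] * averageG g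
      pull g rewrite update-other g c true a≢c | update-other g c false a≢c =
        solve 5 (λ t f i u v → t :* (i :* u) :+ f :* (i :* v) := i :* (t :* u :+ f :* v)) refl
          (bern (q c) true) (bern (q c) false) 𝟙[ g a ≐ b ] (G (update g c true)) (G (update g c false))

  𝟙-shift : ∀ u b c → 𝟙[ u ≐ b ] * 𝟙[ u ≐ c ] ≡ 𝟙[ b ≐ c ] * 𝟙[ u ≐ c ]
  𝟙-shift false false false = refl
  𝟙-shift false false true  = refl
  𝟙-shift false true  false = refl
  𝟙-shift false true  true  = refl
  𝟙-shift true  false false = refl
  𝟙-shift true  false true  = refl
  𝟙-shift true  true  false = refl
  𝟙-shift true  true  true  = refl

  -- prob fixed C is the probability that the constraints C hold when each key carries one independent bit,
  -- equal to b with probability w i b for any query i of that key, given that the constraints fixed hold.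
  module ConstraintProbability {I K : Set} (_≟_ : DecidableEquality K) (key : I → K) (w : I → Bool → ℚ) where

    lookupKey : I → List (I × Bool) → Maybe Bool
    lookupKey i []            = nothing
    lookupKey i ((j , c) ∷ s) = if isYes (key j ≟ key i) then just c else lookupKey i s

    prob : List (I × Bool) → List (I × Bool) → ℚ
    prob fixed []            = 1ℚ
    prob fixed ((i , b) ∷ C) with lookupKey i fixed
    ... | just b′ = 𝟙[ b ≐ b′ ] * prob fixed C
    ... | nothing = w i b * prob ((i , b) ∷ fixed) C

  module _ {I K₁ K₂ : Set} (_≟₁_ : DecidableEquality K₁) (key₁ : I → K₁)
           (_≟₂_ : DecidableEquality K₂) (key₂ : I → K₂) (w : I → Bool → ℚ)
           (key₁⇒key₂ : ∀ {i j} → key₁ i ≡ key₁ j → key₂ i ≡ key₂ j)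
           (key₂⇒key₁ : ∀ {i j} → key₂ i ≡ key₂ j → key₁ i ≡ key₁ j) where
    private
      module P₁ = ConstraintProbability _≟₁_ key₁ w
      module P₂ = ConstraintProbability _≟₂_ key₂ w

    lookupKey-invariant : ∀ i s → P₁.lookupKey i s ≡ P₂.lookupKey i s
    lookupKey-invariant i []            = refl
    lookupKey-invariant i ((j , c) ∷ s) with key₁ j ≟₁ key₁ i | key₂ j ≟₂ key₂ i
    ... | yes _ | yes _ = refl
    ... | yes e | no ne = ⊥-elim (ne (key₁⇒key₂ e))
    ... | no ne | yes e = ⊥-elim (ne (key₂⇒key₁ e))
    ... | no _  | no _  = lookupKey-invariant i s

    prob-invariant : ∀ fixed C → P₁.prob fixed C ≡ P₂.prob fixed C
    prob-invariant fixed []            = refl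
    prob-invariant fixed ((i , b) ∷ C)
      with P₁.lookupKey i fixed | P₂.lookupKey i fixed | lookupKey-invariant i fixed
    ... | just b′ | .(just b′) | refl = cong (𝟙[ b ≐ b′ ] *_) (prob-invariant fixed C)
    ... | nothing | .nothing   | refl = cong (w i b *_) (prob-invariant ((i , b) ∷ fixed) C)

  holds : ∀ {I Ω : Set} → (I → Ω → Bool) → List (I × Bool) → Ω → ℚ
  holds X []            ω = 1ℚ
  holds X ((i , b) ∷ C) ω = 𝟙[ X i ω ≐ b ] * holds X C ω

  holds-cong : ∀ {I Ω : Set} (X : I → Ω → Bool) C {ω ω′} →
               All (λ s → X (proj₁ s) ω ≡ X (proj₁ s) ω′) C → holds X C ω ≡ holds X C ω′
  holds-cong X []            []       = refl
  holds-cong X ((i , b) ∷ C) (e ∷ es) = cong₂ (λ u v → 𝟙[ u ≐ b ] * v) e (holds-cong X C es)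

  module ConstraintExpectation
    {I K Ω : Set} (_≟_ : DecidableEquality K) (key : I → K) (w : I → Bool → ℚ)
    (bit : K → Ω → Bool) (Ex : (Ω → ℚ) → ℚ)
    (Ex-cong : ∀ {F F′ : Ω → ℚ} → (∀ ω → F ω ≡ F′ ω) → Ex F ≡ Ex F′)
    (Ex-*ˡ : ∀ c F → Ex (λ ω → c * F ω) ≡ c * Ex F)
    (Ex-1 : Ex (λ _ → 1ℚ) ≡ 1ℚ)
    (Ex-independent : ∀ i b C → All (λ s → key (proj₁ s) ≢ key i) C →
       Ex (λ ω → 𝟙[ bit (key i) ω ≐ b ] * holds (bit ∘ key) C ω) ≡ w i b * Ex (holds (bit ∘ key) C))
    where
    open ConstraintProbability _≟_ key w

    private
      X : I → Ω → Bool
      X = bit ∘ key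

      swap : ∀ u v h → u * (v * h) ≡ v * (u * h)
      swap = solve 3 (λ u v h → u :* (v :* h) := v :* (u :* h)) refl

    holds-lookupKey-just : ∀ {i b b′} fixed → lookupKey i fixed ≡ just b′ → ∀ ω →
      𝟙[ X i ω ≐ b ] * holds X fixed ω ≡ 𝟙[ b ≐ b′ ] * holds X fixed ω
    holds-lookupKey-just {i} {b} {b′} ((j , c) ∷ s) found ω with key j ≟ key i
    holds-lookupKey-just {i} {b} {.c} ((j , c) ∷ s) refl ω | yes kj≡ki rewrite kj≡ki =
      trans (sym (*-assoc 𝟙[ X i ω ≐ b ] _ _))
        (trans (cong (_* holds X s ω) (𝟙-shift (X i ω) b c)) (*-assoc 𝟙[ b ≐ c ] _ _))
    ... | no _ =
      trans (swap 𝟙[ X i ω ≐ b ] 𝟙[ X j ω ≐ c ] (holds X s ω))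
        (trans (cong (𝟙[ X j ω ≐ c ] *_) (holds-lookupKey-just s found ω))
          (swap 𝟙[ X j ω ≐ c ] 𝟙[ b ≐ b′ ] (holds X s ω)))

    lookupKey-nothing : ∀ {i} fixed → lookupKey i fixed ≡ nothing → All (λ s → key (proj₁ s) ≢ key i) fixed
    lookupKey-nothing []                        _   = []
    lookupKey-nothing {i} ((j , c) ∷ s) missing with key j ≟ key i
    ... | no kj≢ki = kj≢ki ∷ lookupKey-nothing s missing

    Ex-holds-given : ∀ fixed C → Ex (λ ω → holds X C ω * holds X fixed ω) ≡ prob fixed C * Ex (holds X fixed)
    Ex-holds-given fixed [] = trans (Ex-cong (λ ω → *-identityˡ (holds X fixed ω))) (sym (*-identityˡ _))
    Ex-holds-given fixed ((i , b) ∷ C) with lookupKey i fixed in found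
    ... | just b′ = begin
      Ex (λ ω → 𝟙[ X i ω ≐ b ] * holds X C ω * holds X fixed ω)
        ≡⟨ Ex-cong (λ ω → trans (*-assoc 𝟙[ X i ω ≐ b ] (holds X C ω) (holds X fixed ω))
                          (trans (swap 𝟙[ X i ω ≐ b ] (holds X C ω) (holds X fixed ω))
                          (trans (cong (holds X C ω *_) (holds-lookupKey-just fixed found ω))
                                 (swap (holds X C ω) 𝟙[ b ≐ b′ ] (holds X fixed ω))))) ⟩
      Ex (λ ω → 𝟙[ b ≐ b′ ] * (holds X C ω * holds X fixed ω))
        ≡⟨ Ex-*ˡ 𝟙[ b ≐ b′ ] _ ⟩
      𝟙[ b ≐ b′ ] * Ex (λ ω → holds X C ω * holds X fixed ω)
        ≡⟨ cong (𝟙[ b ≐ b′ ] *_) (Ex-holds-given fixed C) ⟩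
      𝟙[ b ≐ b′ ] * (prob fixed C * Ex (holds X fixed))
        ≡⟨ sym (*-assoc 𝟙[ b ≐ b′ ] _ _) ⟩
      𝟙[ b ≐ b′ ] * prob fixed C * Ex (holds X fixed) ∎
    ... | nothing = begin
      Ex (λ ω → 𝟙[ X i ω ≐ b ] * holds X C ω * holds X fixed ω)
        ≡⟨ Ex-cong (λ ω → trans (*-assoc 𝟙[ X i ω ≐ b ] (holds X C ω) (holds X fixed ω))
                                (swap 𝟙[ X i ω ≐ b ] (holds X C ω) (holds X fixed ω))) ⟩
      Ex (λ ω → holds X C ω * holds X ((i , b) ∷ fixed) ω)
        ≡⟨ Ex-holds-given ((i , b) ∷ fixed) C ⟩
      prob ((i , b) ∷ fixed) C * Ex (holds X ((i , b) ∷ fixed))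
        ≡⟨ cong (prob ((i , b) ∷ fixed) C *_) (Ex-independent i b fixed (lookupKey-nothing fixed found)) ⟩
      prob ((i , b) ∷ fixed) C * (w i b * Ex (holds X fixed))
        ≡⟨ solve 3 (λ v u e → v :* (u :* e) := (u :* v) :* e) refl _ (w i b) _ ⟩
      w i b * prob ((i , b) ∷ fixed) C * Ex (holds X fixed) ∎

    Ex-holds : ∀ C → Ex (holds X C) ≡ prob [] C
    Ex-holds C = begin
      Ex (holds X C)                          ≡⟨ Ex-cong (λ ω → sym (*-identityʳ (holds X C ω))) ⟩
      Ex (λ ω → holds X C ω * 1ℚ)             ≡⟨ Ex-holds-given [] C ⟩
      prob [] C * Ex (λ _ → 1ℚ)               ≡⟨ cong (prob [] C *_) Ex-1 ⟩
      prob [] C * 1ℚ                          ≡⟨ *-identityʳ _ ⟩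
      prob [] C                               ∎

module Cube where

  open import Defs
  open import Data.Bool using (Bool; true; false; _∧_)
  import Data.Bool.Properties as Bool
  open import Data.Fin using (Fin; zero; suc)
  open import Data.List using (List; []; _∷_; concatMap)
  open import Data.List.Membership.Propositional using (_∈_)
  open import Data.List.Membership.Propositional.Properties using (∈-concatMap⁺)
  open import Data.List.Relation.Unary.All as All using (All; []; _∷_)
  import Data.List.Relation.Unary.All.Properties as All
  open import Data.List.Relation.Unary.Any as Any using (here; there)
  open import Data.List.Relation.Unary.AllPairs using ([]; _∷_)
  open import Data.List.Relation.Unary.Unique.Propositional using (Unique)
  import Data.List.Relation.Unary.Unique.Propositional.Properties as Unique
  open import Data.Nat using (ℕ; zero; suc; _≤_; z≤n; s≤s)
  import Data.Nat.Properties as ℕ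
  open import Data.Product using (_,_)
  open import Data.Vec using (Vec; []; _∷_; tail)
  import Data.Vec as V
  import Data.Vec.Properties as V
  open import Relation.Binary.PropositionalEquality
  open import Relation.Nullary.Decidable using (isYes; isYes≗does; dec-true)

  concatMap-unique : ∀ {A B : Set} (f : A → List B) (tag : B → A) →
                     (∀ a → All (λ b → tag b ≡ a) (f a)) → (∀ a → Unique (f a)) →
                     ∀ {L} → Unique L → Unique (concatMap f L)
  concatMap-unique f tag tagged unique {[]}    _           = []
  concatMap-unique f tag tagged unique {a ∷ L} (a∉L ∷ uL) =
    Unique.++⁺ (unique a) (concatMap-unique f tag tagged unique uL)
      (λ (b∈fa , b∈rest) → All.lookup (tags-differ L a∉L) b∈rest (sym (All.lookup (tagged a) b∈fa)))
    where
    tags-differ : ∀ L → All (a ≢_) L → All (λ b → a ≢ tag b) (concatMap f L)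
    tags-differ []      []           = []
    tags-differ (a′ ∷ L) (a≢a′ ∷ a∉L) =
      All.++⁺ (All.map (λ tag≡a′ a≡tag → a≢a′ (trans a≡tag tag≡a′)) (tagged a′)) (tags-differ L a∉L)

  allPoints-unique : ∀ n → Unique (allPoints n)
  allPoints-unique zero    = [] ∷ []
  allPoints-unique (suc n) =
    concatMap-unique (λ v → (true ∷ v) ∷ (false ∷ v) ∷ []) tail (λ _ → refl ∷ refl ∷ [])
      (λ _ → ((λ ()) ∷ []) ∷ [] ∷ []) (allPoints-unique n)

  ∈-allPoints : ∀ {n} (v : Point n) → v ∈ allPoints n
  ∈-allPoints []      = here refl
  ∈-allPoints (b ∷ u) =
    ∈-concatMap⁺ (λ v → (true ∷ v) ∷ (false ∷ v) ∷ []) (Any.map (λ { refl → ∈-pair b }) (∈-allPoints u))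
    where
    ∈-pair : ∀ b → (b ∷ u) ∈ (true ∷ u) ∷ (false ∷ u) ∷ []
    ∈-pair true  = here refl
    ∈-pair false = there (here refl)

  eqV-refl : ∀ {n} (u : Point n) → eqV u u ≡ true
  eqV-refl u = trans (isYes≗does (u ≟V u)) (dec-true (u ≟V u) refl)

  restrict-idem : ∀ {n} (S x : Vec Bool n) → restrict S (restrict S x) ≡ restrict S x
  restrict-idem []          []      = refl
  restrict-idem (true ∷ S)  (b ∷ x) = cong (b ∷_) (restrict-idem S x)
  restrict-idem (false ∷ S) (b ∷ x) = cong (false ∷_) (restrict-idem S x)

  restrict-compl-injective : ∀ {n} (S u v : Vec Bool n) →
    restrict S u ≡ restrict S v → restrict (compl S) u ≡ restrict (compl S) v → u ≡ v
  restrict-compl-injective []          []      []      _   _   = refl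
  restrict-compl-injective (true ∷ S)  (a ∷ u) (b ∷ v) on off =
    cong₂ _∷_ (V.∷-injectiveˡ on) (restrict-compl-injective S u v (V.∷-injectiveʳ on) (V.∷-injectiveʳ off))
  restrict-compl-injective (false ∷ S) (a ∷ u) (b ∷ v) on off =
    cong₂ _∷_ (V.∷-injectiveˡ off) (restrict-compl-injective S u v (V.∷-injectiveʳ on) (V.∷-injectiveʳ off))

  dist-∷-≥ : ∀ {n} a b (u v : Point n) → dist u v ≤ dist (a ∷ u) (b ∷ v)
  dist-∷-≥ a b u v with isYes (a Bool.≟ b)
  ... | true  = ℕ.≤-refl
  ... | false = ℕ.n≤1+n _

  dist-restrict-≤ : ∀ {n} (S u v : Vec Bool n) → dist (restrict S u) (restrict S v) ≤ dist u v
  dist-restrict-≤ []          []      []      = z≤n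
  dist-restrict-≤ (true ∷ S)  (a ∷ u) (b ∷ v) with isYes (a Bool.≟ b)
  ... | true  = dist-restrict-≤ S u v
  ... | false = s≤s (dist-restrict-≤ S u v)
  dist-restrict-≤ (false ∷ S) (a ∷ u) (b ∷ v) = ℕ.≤-trans (dist-restrict-≤ S u v) (dist-∷-≥ a b u v)

  foldr-∧-lookup : ∀ {A : Set} {k} (g : A → Bool) (v : Vec A k) →
                   V.foldr _ _∧_ true (V.map g v) ≡ true → ∀ t → g (V.lookup v t) ≡ true
  foldr-∧-lookup g (a ∷ v) all-true zero    = Bool.∧-conicalˡ (g a) _ all-true
  foldr-∧-lookup g (a ∷ v) all-true (suc t) = foldr-∧-lookup g v (Bool.∧-conicalʳ (g a) _ all-true) t

  foldr-∧-allFin : ∀ {k} (g : Fin k → Bool) → V.foldr _ _∧_ true (V.map g (V.allFin k)) ≡ true → ∀ t → g t ≡ true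
  foldr-∧-allFin {k} g all-true t = subst (λ s → g s ≡ true) (V.lookup-allFin t) (foldr-∧-lookup g (V.allFin k) all-true t)

module Indistinguishability where

  open import Defs
  open FiniteProbability
  open Cube
  open import Data.Bool using (Bool; true; false; _∧_; _∨_; not; if_then_else_; T?)
  import Data.Bool.Properties as Bool
  open import Data.Fin using (Fin)
  import Data.Fin.Properties as Fin
  open import Data.List using (List; []; _∷_; map)
  import Data.List as List
  open import Data.List.Membership.Propositional using (_∈_)
  open import Data.List.Membership.Propositional.Properties using (∈-filter⁺; ∈-filter⁻; ∈-concatMap⁺; ∈-map⁺; ∈-allFin)
  open import Data.List.Relation.Unary.All as All using (All; []; _∷_)
  import Data.List.Relation.Unary.All.Properties as All
  import Data.List.Relation.Unary.Any as Any
  open import Data.List.Relation.Unary.Unique.Propositional using (Unique)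
  import Data.List.Relation.Unary.Unique.Propositional.Properties as Unique
  open import Data.Nat using (ℕ; _≤_; _≤ᵇ_)
  import Data.Nat.Properties as ℕ
  open import Data.Product using (_×_; _,_; proj₁; proj₂)
  import Data.Product.Properties as Product
  open import Data.Rational using (ℚ; 0ℚ; 1ℚ; ½; _*_)
  open import Data.Rational.Properties using (*-identityʳ; *-zeroʳ)
  open import Data.Sum using (_⊎_; inj₁; inj₂)
  import Data.Sum.Properties as Sum
  open import Data.Vec using (Vec; []; _∷_)
  import Data.Vec as V
  open import Function using (_∘_; Equivalence)
  open import Relation.Binary.Definitions using (DecidableEquality)
  open import Relation.Binary.PropositionalEquality
  open import Relation.Nullary.Decidable using (isYes; decidable-stable)
  open ≡-Reasoning

  queryConstraints : ∀ {m} → (Fin m → Bool) → List (Fin m × Bool)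
  queryConstraints {m} y = V.toList (V.map (λ i → i , y i) (V.allFin m))

  indicator-all-≐ : ∀ {I Ω : Set} {k} (v : Vec I k) (y F : I → Bool) (X : I → Ω → Bool) ω →
    (∀ i → F i ≡ X i ω) →
    indicator (V.foldr _ _∧_ true (V.map (λ i → isYes (F i Bool.≟ y i)) v)) ≡
    holds X (V.toList (V.map (λ i → i , y i) v)) ω
  indicator-all-≐ []      y F X ω F≗X = refl
  indicator-all-≐ (i ∷ v) y F X ω F≗X =
    trans (indicator-∧ (isYes (F i Bool.≟ y i)) _) (cong₂ _*_ (cong 𝟙[_≐ y i ] (F≗X i)) (indicator-all-≐ v y F X ω F≗X))

  indicator-allMatch : ∀ {n m} {Ω : Set} (x : Fin m → Point n) y f (X : Fin m → Ω → Bool) ω →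
    (∀ i → f (x i) ≡ X i ω) → indicator (allMatch x y f) ≡ holds X (queryConstraints y) ω
  indicator-allMatch {m = m} x y f = indicator-all-≐ (V.allFin m) y (f ∘ x)

  module _ (n r ℓ d : ℕ) (p : ℚ) (χ : Vec Bool n → Point n → Fin (ballSize ℓ d))
           (proper : ProperColoring r ℓ d χ) (m : ℕ) (x : Fin m → Point n) (y : Fin m → Bool) where

    UniformBit : Set
    UniformBit = Point n × Fin (ballSize ℓ d)

    _≟U_ : DecidableEquality UniformBit
    _≟U_ = Product.≡-dec _≟V_ Fin._≟_

    Bit : Set
    Bit = Point n ⊎ UniformBit

    _≟B_ : DecidableEquality Bit
    _≟B_ = Sum.≡-dec _≟V_ _≟U_

    Sample : Set
    Sample = (UniformBit → Bool) × (Point n → Bool)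

    value : Bit → Sample → Bool
    value (inj₁ z) (_  , bv) = bv z
    value (inj₂ u) (yv , _)  = yv u

    bias : Bit → ℚ
    bias (inj₁ _) = p
    bias (inj₂ _) = ½

    bitAt : Vec Bool n → Bool → Point n → Bit
    bitAt J true  z = inj₁ z
    bitAt J false z = inj₂ (restrict (compl J) z , χ J (restrict J z))

    bitOf : Vec Bool n → Point n → Bit
    bitOf J z = bitAt J (prefixNonZero r z) z

    fYES-value : ∀ J yv bv z → fYES n r ℓ d p χ J yv bv z ≡ value (bitOf J z) (yv , bv)
    fYES-value J yv bv z with prefixNonZero r z
    ... | true  = refl
    ... | false = refl

    biasNO : Point n → ℚ
    biasNO z = if prefixNonZero r z then p else ½

    biasNO-bitOf : ∀ J z → biasNO z ≡ bias (bitOf J z)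
    biasNO-bitOf J z with prefixNonZero r z
    ... | true  = refl
    ... | false = refl

    queryLaw : Fin m → Bool → ℚ
    queryLaw i = bern (biasNO (x i))

    private
      C : List (Fin m × Bool)
      C = queryConstraints y

    ExNO : ((Point n → Bool) → ℚ) → ℚ
    ExNO = Eprod _≟V_ (allPoints n) biasNO

    ExNO-independent : ∀ i b S → All (λ s → x (proj₁ s) ≢ x i) S →
      ExNO (λ f → 𝟙[ f (x i) ≐ b ] * holds (λ j f → f (x j)) S f) ≡ queryLaw i b * ExNO (holds (λ j f → f (x j)) S)
    ExNO-independent i b S S-apart =
      Eprod-𝟙 _≟V_ (allPoints n) (allPoints-unique n) (∈-allPoints (x i)) biasNO b _
        (λ h h′ h≗h′ → holds-cong _ S (All.map h≗h′ S-apart))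

    module ProbNO = ConstraintProbability _≟V_ x queryLaw
    module NO = ConstraintExpectation _≟V_ x queryLaw (λ z f → f z) ExNO
      (Eprod-cong _≟V_ (allPoints n) biasNO) (Eprod-*ˡ _≟V_ (allPoints n) biasNO)
      (Eprod-const _≟V_ (allPoints n) biasNO 1ℚ (allPoints-unique n)) ExNO-independent

    PrNO-allMatch : PrNO n r p (allMatch x y) ≡ ProbNO.prob [] C
    PrNO-allMatch = trans (Eprod-cong _≟V_ (allPoints n) biasNO (λ f → indicator-allMatch x y f _ f (λ _ → refl)))
                          (NO.Ex-holds C)

    yD : Vec Bool n → List UniformBit
    yD = yDomain n r ℓ d p χ

    bD : List (Point n)
    bD = bDomain n r ℓ d p χ

    yDomain-unique : ∀ J → Unique (yD J)
    yDomain-unique J =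
      concatMap-unique (λ ρ → map (ρ ,_) (List.allFin _)) proj₁ (λ _ → All.map⁺ (All.tabulate (λ _ → refl)))
        (λ _ → Unique.map⁺ (cong proj₂) (Unique.allFin⁺ _)) (Unique.filter⁺ _ (allPoints-unique n))

    bDomain-unique : Unique bD
    bDomain-unique = Unique.filter⁺ (T? ∘ prefixNonZero r) (allPoints-unique n)

    InDomain : Vec Bool n → Bit → Set
    InDomain J (inj₁ z) = z ∈ bD
    InDomain J (inj₂ u) = u ∈ yD J

    bitAt-in-domain : ∀ J b z → prefixNonZero r z ≡ b → InDomain J (bitAt J b z)
    bitAt-in-domain J true  z nonzero = ∈-filter⁺ (T? ∘ prefixNonZero r) (∈-allPoints z) (Equivalence.from Bool.T-≡ nonzero)
    bitAt-in-domain J false z _       =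
      ∈-concatMap⁺ (λ ρ → map (ρ ,_) (List.allFin _))
        (Any.map (λ { refl → ∈-map⁺ (ρ ,_) (∈-allFin _) })
          (∈-filter⁺ (T? ∘ λ v → eqV (restrict (compl J) v) v) (∈-allPoints ρ)
            (Equivalence.from Bool.T-≡ (trans (cong (λ u → eqV u ρ) (restrict-idem (compl J) z)) (eqV-refl ρ)))))
      where
      ρ = restrict (compl J) z

    bitOf-in-domain : ∀ J z → InDomain J (bitOf J z)
    bitOf-in-domain J z = bitAt-in-domain J (prefixNonZero r z) z refl

    ExY : Vec Bool n → (Sample → ℚ) → ℚ
    ExY J F = Eprod _≟U_ (yD J) (λ _ → ½) (λ yv → Eprod _≟V_ bD (λ _ → p) (λ bv → F (yv , bv)))

    ExY-cong : ∀ J {F F′ : Sample → ℚ} → (∀ ω → F ω ≡ F′ ω) → ExY J F ≡ ExY J F′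
    ExY-cong J F≗F′ = Eprod-cong _≟U_ (yD J) _ (λ yv → Eprod-cong _≟V_ bD _ (λ bv → F≗F′ (yv , bv)))

    ExY-*ˡ : ∀ J c F → ExY J (λ ω → c * F ω) ≡ c * ExY J F
    ExY-*ˡ J c F = trans (Eprod-cong _≟U_ (yD J) _ (λ yv → Eprod-*ˡ _≟V_ bD _ c _)) (Eprod-*ˡ _≟U_ (yD J) _ c _)

    ExY-const : ∀ J c → ExY J (λ _ → c) ≡ c
    ExY-const J c = trans (Eprod-cong _≟U_ (yD J) _ (λ yv → Eprod-const _≟V_ bD _ c bDomain-unique))
                          (Eprod-const _≟U_ (yD J) _ c (yDomain-unique J))

    queriedBit : Vec Bool n → Fin m → Sample → Bool
    queriedBit J i = value (bitOf J (x i))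

    ExY-𝟙 : ∀ J k b S → InDomain J k → All (λ s → bitOf J (x (proj₁ s)) ≢ k) S →
      ExY J (λ ω → 𝟙[ value k ω ≐ b ] * holds (queriedBit J) S ω) ≡ bern (bias k) b * ExY J (holds (queriedBit J) S)
    ExY-𝟙 J (inj₁ z) b S z∈bD S-apart =
      trans (Eprod-cong _≟U_ (yD J) _ (λ yv →
              Eprod-𝟙 _≟V_ bD bDomain-unique z∈bD _ b (λ bv → holds (queriedBit J) S (yv , bv)) (ignores yv)))
            (Eprod-*ˡ _≟U_ (yD J) _ (bern p b) _)
      where
      ignores : ∀ yv → Ignores _≟V_ z (λ bv → holds (queriedBit J) S (yv , bv))
      ignores yv h h′ h≗h′ = holds-cong _ S (All.map (λ {s} → agree (bitOf J (x (proj₁ s)))) S-apart)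
        where
        agree : ∀ k → k ≢ inj₁ z → value k (yv , h) ≡ value k (yv , h′)
        agree (inj₁ z′) z′≢z = h≗h′ (z′≢z ∘ cong inj₁)
        agree (inj₂ _)  _    = refl
    ExY-𝟙 J (inj₂ u) b S u∈yD S-apart =
      trans (Eprod-cong _≟U_ (yD J) _ (λ yv → Eprod-*ˡ _≟V_ bD _ 𝟙[ yv u ≐ b ] _))
            (Eprod-𝟙 _≟U_ (yD J) (yDomain-unique J) u∈yD _ b _ ignores)
      where
      ignores : Ignores _≟U_ u (λ yv → Eprod _≟V_ bD (λ _ → p) (λ bv → holds (queriedBit J) S (yv , bv)))
      ignores h h′ h≗h′ = Eprod-cong _≟V_ bD _ (λ bv →
        holds-cong _ S (All.map (λ {s} → agree bv (bitOf J (x (proj₁ s)))) S-apart))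
        where
        agree : ∀ bv k → k ≢ inj₂ u → value k (h , bv) ≡ value k (h′ , bv)
        agree bv (inj₁ _)  _    = refl
        agree bv (inj₂ u′) u′≢u = h≗h′ (u′≢u ∘ cong inj₂)

    ExY-independent : ∀ J i b S → All (λ s → bitOf J (x (proj₁ s)) ≢ bitOf J (x i)) S →
      ExY J (λ ω → 𝟙[ queriedBit J i ω ≐ b ] * holds (queriedBit J) S ω) ≡ queryLaw i b * ExY J (holds (queriedBit J) S)
    ExY-independent J i b S S-apart =
      trans (ExY-𝟙 J (bitOf J (x i)) b S (bitOf-in-domain J (x i)) S-apart)
            (cong (λ q → bern q b * _) (sym (biasNO-bitOf J (x i))))

    module ProbYES (J : Vec Bool n) = ConstraintProbability _≟B_ (bitOf J ∘ x) queryLaw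
    module YES (J : Vec Bool n) = ConstraintExpectation _≟B_ (bitOf J ∘ x) queryLaw value (ExY J)
      (ExY-cong J) (ExY-*ˡ J) (ExY-const J 1ℚ) (ExY-independent J)

    module _ (J : Vec Bool n) (J-valid : validJ r ℓ J ≡ true) (E : eventE d x J ≡ true) where

      close-off-J : ∀ i j → restrict (compl J) (x i) ≡ restrict (compl J) (x j) → dist (x i) (x j) ≤ d
      close-off-J i j same-off =
        ℕ.≤ᵇ⇒≤ _ _ (Equivalence.from Bool.T-≡
          (subst (λ a → not a ∨ (dist (x i) (x j) ≤ᵇ d) ≡ true)
                 (trans (cong (eqV _) (sym same-off)) (eqV-refl _))
                 (foldr-∧-allFin _ (foldr-∧-allFin _ E i) j)))

      -- Queries reading the same uniform bit agree off J, so E makes them d-close, and then the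
      -- proper colouring forces them to agree on J as well.
      bitAt-injective : ∀ i j bi bj → bitAt J bi (x i) ≡ bitAt J bj (x j) → x i ≡ x j
      bitAt-injective i j true  true  same = Sum.inj₁-injective same
      bitAt-injective i j false false same = decidable-stable (x i ≟V x j) λ xi≢xj →
        proper J J-valid (x i) (x j)
          (λ same-on → xi≢xj (restrict-compl-injective J (x i) (x j) same-on same-off))
          (ℕ.≤-trans (dist-restrict-≤ J (x i) (x j)) (close-off-J i j same-off))
          (cong proj₂ (Sum.inj₂-injective same))
        where
        same-off = cong proj₁ (Sum.inj₂-injective same)

      bitOf-injective : ∀ {i j} → bitOf J (x i) ≡ bitOf J (x j) → x i ≡ x j
      bitOf-injective {i} {j} = bitAt-injective i j _ _

      ExY-allMatch : ExY J (λ ω → indicator (allMatch x y (fYES n r ℓ d p χ J (proj₁ ω) (proj₂ ω))))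
                     ≡ PrNO n r p (allMatch x y)
      ExY-allMatch = begin
        ExY J (λ ω → indicator (allMatch x y (fYES n r ℓ d p χ J (proj₁ ω) (proj₂ ω))))
          ≡⟨ ExY-cong J (λ ω → indicator-allMatch x y (fYES n r ℓ d p χ J (proj₁ ω) (proj₂ ω)) (queriedBit J) ω
                                       (λ i → fYES-value J (proj₁ ω) (proj₂ ω) (x i))) ⟩
        ExY J (holds (queriedBit J) C)
          ≡⟨ YES.Ex-holds J C ⟩
        ProbYES.prob J [] C
          ≡⟨ sym (prob-invariant _≟V_ x _≟B_ (bitOf J ∘ x) queryLaw (cong (bitOf J)) bitOf-injective [] C) ⟩
        ProbNO.prob [] C
          ≡⟨ sym PrNO-allMatch ⟩
        PrNO n r p (allMatch x y) ∎

    ExY-allMatch∧E : ∀ {J} → J ∈ allValidJ n r ℓ →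
      ExY J (λ ω → indicator (allMatch x y (fYES n r ℓ d p χ J (proj₁ ω) (proj₂ ω)) ∧ eventE d x J))
      ≡ PrNO n r p (allMatch x y) * ExY J (λ _ → indicator (eventE d x J))
    ExY-allMatch∧E {J} J∈ with eventE d x J in E
    ... | true = begin
      ExY J (λ ω → indicator (match ω ∧ true))  ≡⟨ ExY-cong J (λ ω → cong indicator (Bool.∧-identityʳ (match ω))) ⟩
      ExY J (λ ω → indicator (match ω))         ≡⟨ ExY-allMatch J J-valid E ⟩
      PrNO n r p (allMatch x y)                 ≡⟨ sym (*-identityʳ _) ⟩
      PrNO n r p (allMatch x y) * 1ℚ            ≡⟨ cong (PrNO n r p (allMatch x y) *_) (sym (ExY-const J 1ℚ)) ⟩
      PrNO n r p (allMatch x y) * ExY J (λ _ → 1ℚ) ∎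
      where
      match : Sample → Bool
      match ω = allMatch x y (fYES n r ℓ d p χ J (proj₁ ω) (proj₂ ω))
      J-valid = Equivalence.to Bool.T-≡ (proj₂ (∈-filter⁻ (T? ∘ validJ r ℓ) {xs = allPoints n} J∈))
    ... | false = begin
      ExY J (λ ω → indicator (match ω ∧ false)) ≡⟨ ExY-cong J (λ ω → cong indicator (Bool.∧-zeroʳ (match ω))) ⟩
      ExY J (λ _ → 0ℚ)                          ≡⟨ ExY-const J 0ℚ ⟩
      0ℚ                                        ≡⟨ sym (*-zeroʳ (PrNO n r p (allMatch x y))) ⟩
      PrNO n r p (allMatch x y) * 0ℚ            ≡⟨ cong (PrNO n r p (allMatch x y) *_) (sym (ExY-const J 0ℚ)) ⟩
      PrNO n r p (allMatch x y) * ExY J (λ _ → 0ℚ) ∎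
      where
      match : Sample → Bool
      match ω = allMatch x y (fYES n r ℓ d p χ J (proj₁ ω) (proj₂ ω))

    PrYES-allMatch∧E : PrYES n r ℓ d p χ (λ J f → allMatch x y f ∧ eventE d x J)
                       ≡ PrNO n r p (allMatch x y) * PrYES n r ℓ d p χ (λ J f → eventE d x J)
    PrYES-allMatch∧E = trans (Eunif-cong (allValidJ n r ℓ) ExY-allMatch∧E)
                             (Eunif-*ˡ (PrNO n r p (allMatch x y)) _ (allValidJ n r ℓ))

open import Defs
open import Data.Bool using (Bool; _∧_)
open import Data.Nat using (ℕ; _≤_; _<_; _+_)
open import Data.Fin using (Fin)
open import Data.Vec using (Vec)
open import Data.Rational using (ℚ; 0ℚ; ½; Positive) renaming (_≤_ to _≤ℚ_; _<_ to _<ℚ_)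
open import Relation.Binary.PropositionalEquality using (_≡_; cong; trans)
open FiniteProbability using (condProb-*ˡ)
open Indistinguishability using (PrYES-allMatch∧E)

lemma16 : (k ℓ r d : ℕ) → 1 ≤ ℓ → r < k → d ≤ ℓ →
          (p : ℚ) → 0ℚ ≤ℚ p → p <ℚ ½ →
          (χ : Vec Bool (k + ℓ) → Point (k + ℓ) → Fin (ballSize ℓ d)) →
          ProperColoring r ℓ d χ →
          (m : ℕ) (x : Fin m → Point (k + ℓ)) (y : Fin m → Bool) →
          (posE : Positive (PrYES (k + ℓ) r ℓ d p χ (λ J f → eventE d x J))) →
          condProb (PrYES (k + ℓ) r ℓ d p χ (λ J f → allMatch x y f ∧ eventE d x J))
                   (PrYES (k + ℓ) r ℓ d p χ (λ J f → eventE d x J)) posE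
            ≡ PrNO (k + ℓ) r p (λ f → allMatch x y f)
lemma16 k ℓ r d _ _ _ p _ _ χ proper m x y posE =
  trans (cong (λ A → condProb A _ posE) (PrYES-allMatch∧E (k + ℓ) r ℓ d p χ proper m x y))
        (condProb-*ˡ _ _ posE)
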